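{- Let $S=\{s_1<\cdots<s_{k_1}\}$ and $T=\{t_1<\cdots<t_{k_2}\}$ be nonempty subsets of $\{1,\ldots,n-1\}$ and let $d=\gcd\{s+t\mid s\in S,\ t\in T\}$. Then there exist integers $a_1,\ldots,a_{k_1},b_1,\ldots,b_{k_2}$ such that \[d=\sum_{i=1}^{k_1}a_is_i-\sum_{i=1}^{k_2}b_it_i\quad\text{and}\quad\sum_{i=1}^{k_1}a_i+\sum_{i=1}^{k_2}b_i=0.\] -}

module Defs where

open import Data.Nat using (ℕ; zero; suc)
open import Data.Nat.GCD using (gcd)
open import Data.Fin using (Fin; zero; suc)
open import Data.Integer using (ℤ; 0ℤ; _+_)

∑ : (k : ℕ) → (Fin k → ℤ) → ℤ
∑ zero    f = 0ℤ
∑ (suc k) f = f zero + ∑ k (λ i → f (suc i))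

gcdFam : (k : ℕ) → (Fin k → ℕ) → ℕ
gcdFam zero    f = 0
gcdFam (suc k) f = gcd (f zero) (gcdFam k (λ i → f (suc i)))

gcdSums : (k₁ k₂ : ℕ) → (Fin k₁ → ℕ) → (Fin k₂ → ℕ) → ℕ
gcdSums k₁ k₂ s t = gcdFam k₁ (λ i → gcdFam k₂ (λ j → s i Data.Nat.+ t j))

-- The integers  ∑ aᵢ sᵢ − ∑ bⱼ tⱼ  with  ∑ aᵢ + ∑ bⱼ = 0  form an ideal of ℤ:
-- the coefficient constraint is linear, so it survives sums and integer
-- multiples.  Choosing a = eᵢ and b = −eⱼ shows that this ideal contains
-- every sᵢ + tⱼ, and an ideal containing m and n contains gcd m n by Bézout;
-- hence it contains the gcd of all the sᵢ + tⱼ.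
module Submission where

open import Defs
open import Data.Nat using (ℕ; suc; _≤_; _<_)
open import Data.Fin using (Fin)
open import Data.Integer using (ℤ; _+_; _-_; _*_; 0ℤ; +_)
open import Data.Product using (Σ; _×_; _,_)
open import Relation.Binary.PropositionalEquality using (_≡_)

import Data.Nat as ℕ
open import Data.Nat.GCD using (gcd; gcd-GCD; module Bézout)
open import Data.Fin using (zero; suc)
open import Data.Integer using (-_; 1ℤ; -1ℤ)
open import Data.Integer.Properties
  using (+-*-semiring; +-identityˡ; +-identityʳ; *-identityˡ; *-identityʳ;
         *-distribʳ-+; *-assoc; *-zeroʳ; *-distribˡ-+; neg-distribˡ-*; pos-*; +-comm)
open import Data.Integer.Tactic.RingSolver using (solve-∀)
open import Data.Product using (∃₂)
open import Data.Vec.Functional using (Vector)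
open import Relation.Binary.PropositionalEquality
  using (refl; sym; trans; cong; cong₂; subst; module ≡-Reasoning)
open import Algebra.Properties.Semiring.Sum +-*-semiring
  using (sum; sum-cong-≗; ∑-distrib-+; *-distribˡ-sum; sum-replicate-zero)

open ≡-Reasoning

private
  variable
    k k₁ k₂ : ℕ

record IsIdeal (P : ℤ → Set) : Set where
  field
    0∈       : P 0ℤ
    +-closed : ∀ {x y} → P x → P y → P (x + y)
    *-closed : ∀ c {x} → P x → P (c * x)

ℕ-eq⇒lincomb : ∀ d x m y n → d ℕ.+ y ℕ.* n ≡ x ℕ.* m → + d ≡ + x * + m + - + y * + n
ℕ-eq⇒lincomb d x m y n eq = begin
  + d                             ≡⟨ cancel (+ d) (+ y * + n) ⟩
  + d + + y * + n - + y * + n     ≡⟨ cong (λ r → + d + r - + y * + n) (pos-* y n) ⟨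
  + (d ℕ.+ y ℕ.* n) - + y * + n   ≡⟨ cong (λ r → + r - + y * + n) eq ⟩
  + (x ℕ.* m) - + y * + n         ≡⟨ cong (_- + y * + n) (pos-* x m) ⟩
  + x * + m - + y * + n           ≡⟨ cong (λ r → + x * + m + r) (neg-distribˡ-* (+ y) (+ n)) ⟩
  + x * + m + - + y * + n         ∎
  where cancel : ∀ d p → d ≡ d + p - p
        cancel = solve-∀

gcd-lincomb : ∀ m n → ∃₂ λ u v → + gcd m n ≡ u * + m + v * + n
gcd-lincomb m n with Bézout.identity (gcd-GCD m n)
... | Bézout.+- x y eq = + x , - + y , ℕ-eq⇒lincomb (gcd m n) x m y n eq
... | Bézout.-+ x y eq = - + x , + y ,
  trans (ℕ-eq⇒lincomb (gcd m n) y n x m eq) (+-comm (+ y * + n) (- + x * + m))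

module _ {P : ℤ → Set} (ideal : IsIdeal P) where
  open IsIdeal ideal

  gcd∈ : ∀ {m n} → P (+ m) → P (+ n) → P (+ gcd m n)
  gcd∈ {m} {n} m∈ n∈ with gcd-lincomb m n
  ... | u , v , eq = subst P (sym eq) (+-closed (*-closed u m∈) (*-closed v n∈))

  gcdFam∈ : ∀ k (f : Fin k → ℕ) → (∀ i → P (+ f i)) → P (+ gcdFam k f)
  gcdFam∈ ℕ.zero    f f∈ = 0∈
  gcdFam∈ (ℕ.suc k) f f∈ =
    gcd∈ (f∈ zero) (gcdFam∈ k (λ i → f (suc i)) (λ i → f∈ (suc i)))

∑≡sum : ∀ k (f : Fin k → ℤ) → ∑ k f ≡ sum f
∑≡sum ℕ.zero    f = refl
∑≡sum (ℕ.suc k) f = cong (λ r → f zero + r) (∑≡sum k (λ i → f (suc i)))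

⟨_,_⟩ : Vector ℤ k → Vector ℤ k → ℤ
⟨ a , x ⟩ = sum (λ i → a i * x i)

⟨⟩-distribʳ-+ : (a a′ x : Vector ℤ k) → ⟨ (λ i → a i + a′ i) , x ⟩ ≡ ⟨ a , x ⟩ + ⟨ a′ , x ⟩
⟨⟩-distribʳ-+ a a′ x =
  trans (sum-cong-≗ (λ i → *-distribʳ-+ (x i) (a i) (a′ i)))
        (∑-distrib-+ (λ i → a i * x i) (λ i → a′ i * x i))

⟨⟩-*ˡ : ∀ c (a x : Vector ℤ k) → ⟨ (λ i → c * a i) , x ⟩ ≡ c * ⟨ a , x ⟩
⟨⟩-*ˡ c a x = trans (sum-cong-≗ (λ i → *-assoc c (a i) (x i))) (sym (*-distribˡ-sum c (λ i → a i * x i)))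

δ : Fin k → Fin k → ℤ
δ zero    zero    = 1ℤ
δ zero    (suc _) = 0ℤ
δ (suc _) zero    = 0ℤ
δ (suc i) (suc j) = δ i j

⟨δ,⟩ : (i : Fin k) (x : Vector ℤ k) → ⟨ δ i , x ⟩ ≡ x i
⟨δ,⟩ {ℕ.suc k} zero x = begin
  1ℤ * x zero + sum {k} (λ _ → 0ℤ) ≡⟨ cong₂ _+_ (*-identityˡ (x zero)) (sum-replicate-zero k) ⟩
  x zero + 0ℤ                      ≡⟨ +-identityʳ (x zero) ⟩
  x zero                           ∎
⟨δ,⟩ (suc i) x = trans (+-identityˡ _) (⟨δ,⟩ i (λ j → x (suc j)))

sum-δ : (i : Fin k) → sum (δ i) ≡ 1ℤ
sum-δ i = trans (sum-cong-≗ (λ j → sym (*-identityʳ (δ i j)))) (⟨δ,⟩ i (λ _ → 1ℤ))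

BalancedCombination : Vector ℤ k₁ → Vector ℤ k₂ → ℤ → Set
BalancedCombination {k₁} {k₂} x y z =
  Σ (Vector ℤ k₁) λ a → Σ (Vector ℤ k₂) λ b →
    (z ≡ ⟨ a , x ⟩ - ⟨ b , y ⟩) × (sum a + sum b ≡ 0ℤ)

module _ (x : Vector ℤ k₁) (y : Vector ℤ k₂) where

  balanced-isIdeal : IsIdeal (BalancedCombination x y)
  balanced-isIdeal = record { 0∈ = 0∈ ; +-closed = +-closed ; *-closed = *-closed }
    where
    0∈ : BalancedCombination x y 0ℤ
    0∈ = (λ _ → 0ℤ) , (λ _ → 0ℤ) ,
         sym (cong₂ _-_ (sum-replicate-zero k₁) (sum-replicate-zero k₂)) ,
         cong₂ _+_ (sum-replicate-zero k₁) (sum-replicate-zero k₂)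

    +-closed : ∀ {z z′} → BalancedCombination x y z → BalancedCombination x y z′ →
               BalancedCombination x y (z + z′)
    +-closed {z} {z′} (a , b , z≡ , ab) (a′ , b′ , z′≡ , ab′) =
      (λ i → a i + a′ i) , (λ j → b j + b′ j) ,
      (begin
        z + z′                                               ≡⟨ cong₂ _+_ z≡ z′≡ ⟩
        (⟨ a , x ⟩ - ⟨ b , y ⟩) + (⟨ a′ , x ⟩ - ⟨ b′ , y ⟩)  ≡⟨ interchange ⟨ a , x ⟩ ⟨ b , y ⟩ ⟨ a′ , x ⟩ ⟨ b′ , y ⟩ ⟩
        (⟨ a , x ⟩ + ⟨ a′ , x ⟩) - (⟨ b , y ⟩ + ⟨ b′ , y ⟩)  ≡⟨ cong₂ _-_ (⟨⟩-distribʳ-+ a a′ x) (⟨⟩-distribʳ-+ b b′ y) ⟨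
        ⟨ (λ i → a i + a′ i) , x ⟩ - ⟨ (λ j → b j + b′ j) , y ⟩ ∎) ,
      (begin
        sum (λ i → a i + a′ i) + sum (λ j → b j + b′ j) ≡⟨ cong₂ _+_ (∑-distrib-+ a a′) (∑-distrib-+ b b′) ⟩
        (sum a + sum a′) + (sum b + sum b′)             ≡⟨ regroup (sum a) (sum a′) (sum b) (sum b′) ⟩
        (sum a + sum b) + (sum a′ + sum b′)             ≡⟨ cong₂ _+_ ab ab′ ⟩
        0ℤ                                              ∎)
      where
      interchange : ∀ p q p′ q′ → (p - q) + (p′ - q′) ≡ (p + p′) - (q + q′)
      interchange = solve-∀
      regroup : ∀ p p′ q q′ → (p + p′) + (q + q′) ≡ (p + q) + (p′ + q′)
      regroup = solve-∀

    *-closed : ∀ c {z} → BalancedCombination x y z → BalancedCombination x y (c * z)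
    *-closed c {z} (a , b , z≡ , ab) =
      (λ i → c * a i) , (λ j → c * b j) ,
      (begin
        c * z                                ≡⟨ cong (c *_) z≡ ⟩
        c * (⟨ a , x ⟩ - ⟨ b , y ⟩)          ≡⟨ *-distribˡ-minus c _ _ ⟩
        c * ⟨ a , x ⟩ - c * ⟨ b , y ⟩        ≡⟨ cong₂ _-_ (⟨⟩-*ˡ c a x) (⟨⟩-*ˡ c b y) ⟨
        ⟨ (λ i → c * a i) , x ⟩ - ⟨ (λ j → c * b j) , y ⟩ ∎) ,
      (begin
        sum (λ i → c * a i) + sum (λ j → c * b j) ≡⟨ cong₂ _+_ (*-distribˡ-sum c a) (*-distribˡ-sum c b) ⟨
        c * sum a + c * sum b                     ≡⟨ *-distribˡ-+ c (sum a) (sum b) ⟨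
        c * (sum a + sum b)                       ≡⟨ cong (c *_) ab ⟩
        c * 0ℤ                                    ≡⟨ *-zeroʳ c ⟩
        0ℤ                                        ∎)
      where
      *-distribˡ-minus : ∀ c p q → c * (p - q) ≡ c * p - c * q
      *-distribˡ-minus = solve-∀

  balanced-+ : ∀ i j → BalancedCombination x y (x i + y j)
  balanced-+ i j = δ i , (λ j′ → -1ℤ * δ j j′) ,
    (begin
      x i + y j                              ≡⟨ sub-neg (x i) (y j) ⟩
      x i - -1ℤ * y j                        ≡⟨ cong₂ (λ p q → p - -1ℤ * q) (⟨δ,⟩ i x) (⟨δ,⟩ j y) ⟨
      ⟨ δ i , x ⟩ - -1ℤ * ⟨ δ j , y ⟩        ≡⟨ cong (λ r → ⟨ δ i , x ⟩ - r) (⟨⟩-*ˡ -1ℤ (δ j) y) ⟨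
      ⟨ δ i , x ⟩ - ⟨ (λ j′ → -1ℤ * δ j j′) , y ⟩ ∎) ,
    (begin
      sum (δ i) + sum (λ j′ → -1ℤ * δ j j′) ≡⟨ cong (λ r → sum (δ i) + r) (*-distribˡ-sum -1ℤ (δ j)) ⟨
      sum (δ i) + -1ℤ * sum (δ j)           ≡⟨ cong₂ (λ p q → p + -1ℤ * q) (sum-δ i) (sum-δ j) ⟩
      1ℤ + -1ℤ * 1ℤ                         ≡⟨⟩
      0ℤ                                    ∎)
    where
    sub-neg : ∀ p q → p + q ≡ p - -1ℤ * q
    sub-neg = solve-∀

balanced⇒∑ : (x : Vector ℤ k₁) (y : Vector ℤ k₂) {z : ℤ} → BalancedCombination x y z →
             Σ (Vector ℤ k₁) λ a → Σ (Vector ℤ k₂) λ b →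
               (z ≡ ∑ k₁ (λ i → a i * x i) - ∑ k₂ (λ j → b j * y j)) × (∑ k₁ a + ∑ k₂ b ≡ 0ℤ)
balanced⇒∑ {k₁} {k₂} x y (a , b , z≡ , ab) =
  a , b ,
  trans z≡ (sym (cong₂ _-_ (∑≡sum k₁ (λ i → a i * x i)) (∑≡sum k₂ (λ j → b j * y j)))) ,
  trans (cong₂ _+_ (∑≡sum k₁ a) (∑≡sum k₂ b)) ab

lemma4p1 : (n k₁ k₂ : ℕ) (s : Fin k₁ → ℕ) (t : Fin k₂ → ℕ) →
           1 ≤ k₁ → 1 ≤ k₂ →
           (∀ (i j : Fin k₁) → Data.Fin._<_ i j → s i < s j) →
           (∀ (i j : Fin k₂) → Data.Fin._<_ i j → t i < t j) →
           (∀ (i : Fin k₁) → 1 ≤ s i × suc (s i) ≤ n) →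
           (∀ (j : Fin k₂) → 1 ≤ t j × suc (t j) ≤ n) →
           Σ (Fin k₁ → ℤ) λ a → Σ (Fin k₂ → ℤ) λ b →
             (+ gcdSums k₁ k₂ s t ≡ ∑ k₁ (λ i → a i * + s i) - ∑ k₂ (λ j → b j * + t j))
             × (∑ k₁ a + ∑ k₂ b ≡ 0ℤ)
lemma4p1 n k₁ k₂ s t _ _ _ _ _ _ =
  balanced⇒∑ x y (gcdFam∈ ideal k₁ _ (λ i → gcdFam∈ ideal k₂ _ (balanced-+ x y i)))
  where
  x : Vector ℤ k₁
  x i = + s i
  y : Vector ℤ k₂
  y j = + t j
  ideal : IsIdeal (BalancedCombination x y)
  ideal = balanced-isIdeal x y
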